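{- Define integer polynomials $G_i(x)$ by $G_0(x)=1$, $G_1(x)=x$, and $G_i(x)=xG_{i-1}(x)-G_{i-2}(x)$ for $i\geq 2$. For an integer $k$, the chain $\mathfrak{C}_k$ is the sequence $\langle G_i(k)\rangle_{i\geq 2}$. Then for every integer $n\geq 2$, the number of integers $k\geq 3$ such that $n$ appears in $\mathfrak{C}_k$ is strictly less than $\log_2 n$.
   Context: $G_i$ and $\mathfrak{C}_k$ are as defined in the claim. -}

module Defs where

open import Data.Nat using (ℕ; zero; suc)
open import Data.Integer using (ℤ; +_; _*_; _-_)

G : ℕ → ℤ → ℤ
G zero x = + 1
G (suc zero) x = x
G (suc (suc i)) x = x * G (suc i) x - G i x

{-# OPTIONS --safe #-}
module Submission where

-- For k ≥ 3 the chain ℭ_k at least doubles at every step, because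
-- G_{i+2}(k) − 2G_{i+1}(k) = (k−3)G_{i+1}(k) + (G_{i+1}(k) − 2G_i(k)) + G_i(k) ≥ 0; so G_i(k) ≥ 2^i
-- and n can only sit at a position 2 ≤ i ≤ ⌈log₂ n⌉. For k ≤ k' the difference G_i(k') − G_i(k)
-- obeys the same recurrence plus the nonnegative term (k'−k)G_{i+1}(k), so it is nondecreasing and
-- at least k' − k > 0 when k ≠ k'. Hence each position holds n in at most one chain, and at most
-- ⌈log₂ n⌉ − 1 chains contain n.

open import Defs
open import Data.Nat using (ℕ; _≤_; _<_)
open import Data.Nat.Logarithm using (⌈log₂_⌉)
open import Data.Integer using (+_)
open import Data.List using (List; length)
open import Data.List.Relation.Unary.All using (All)
open import Data.List.Relation.Unary.Unique.Propositional using (Unique)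
open import Data.Product using (_×_; ∃-syntax)
open import Relation.Binary.PropositionalEquality using (_≡_)

open import Data.Nat using (zero; suc; pred; _^_; z≤n; s≤s; NonZero; >-nonZero)
import Data.Nat.Properties as ℕ
open import Data.Nat.Logarithm using (⌈log₂⌉-mono-≤; ⌈log₂2^n⌉≡n)
open import Data.Integer as ℤ using (ℤ; 0ℤ; +≤+; _*_; _-_; _+_; nonNegative)
open import Data.Integer.Properties
  using (≤-refl; ≤-trans; +-mono-≤; *-monoˡ-≤-nonNeg; *-monoʳ-≤-nonNeg;
         *-identityˡ; *-identityʳ; *-assoc; pos-*; +-identityʳ; +-inverseʳ; drop‿+≤+;
         i≤j⇒0≤j-i; 0≤i-j⇒j≤i; i-j≤0⇒i≤j; module ≤-Reasoning)
open import Data.Integer.Tactic.RingSolver using (solve-∀)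
open import Data.Fin as Fin using (Fin; toℕ; fromℕ<)
open import Data.Fin.Properties using (toℕ-fromℕ<; injective⇒≤)
open import Data.List using (_∷_; lookup)
import Data.List.Relation.Unary.All as All
open import Data.List.Relation.Unary.AllPairs using (_∷_)
open import Data.List.Membership.Propositional using (_∈_)
open import Data.List.Membership.Propositional.Properties using (∈-lookup)
open import Data.Product using (∃; _,_; proj₁; proj₂)
open import Data.Sum using (inj₁; inj₂)
open import Function.Definitions using (Injective)
open import Relation.Binary.PropositionalEquality using (refl; sym; trans; cong; subst)
open import Relation.Nullary using (contradiction)

0≤i*j : ∀ {i j} → 0ℤ ℤ.≤ i → 0ℤ ℤ.≤ j → 0ℤ ℤ.≤ i * j
0≤i*j {+ m} {+ n} _ _ = subst (0ℤ ℤ.≤_) (pos-* m n) (+≤+ z≤n)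

0≤2*i : ∀ {i} → 0ℤ ℤ.≤ i → 0ℤ ℤ.≤ + 2 * i
0≤2*i = 0≤i*j {+ 2} (+≤+ z≤n)

excess-identity : ∀ x a b e → (x * b - a + e) - + 2 * b ≡ (x - + 3) * b + (b - + 2 * a) + a + e
excess-identity = solve-∀

difference-identity : ∀ x y a b a' b' →
  (y * b' - a') - (x * b - a) ≡ y * (b' - b) - (a' - a) + (y - x) * b
difference-identity = solve-∀

module PerturbedRecurrence
  (x : ℤ) (3≤x : + 3 ℤ.≤ x) (a e : ℕ → ℤ)
  (recurrence : ∀ i → a (suc (suc i)) ≡ x * a (suc i) - a i + e i)
  (0≤e : ∀ i → 0ℤ ℤ.≤ e i) (0≤a₀ : 0ℤ ℤ.≤ a 0) (2a₀≤a₁ : + 2 * a 0 ℤ.≤ a 1)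
  where

  doubling-step : ∀ i → 0ℤ ℤ.≤ a i → + 2 * a i ℤ.≤ a (suc i) →
                  + 2 * a (suc i) ℤ.≤ a (suc (suc i))
  doubling-step i 0≤aᵢ 2aᵢ≤aᵢ₊₁ = 0≤i-j⇒j≤i (subst (0ℤ ℤ.≤_) (sym excess) 0≤sum)
    where
    excess : a (suc (suc i)) - + 2 * a (suc i)
           ≡ (x - + 3) * a (suc i) + (a (suc i) - + 2 * a i) + a i + e i
    excess = trans (cong (_- + 2 * a (suc i)) (recurrence i))
                   (excess-identity x (a i) (a (suc i)) (e i))
    0≤sum : 0ℤ ℤ.≤ (x - + 3) * a (suc i) + (a (suc i) - + 2 * a i) + a i + e i
    0≤sum = +-mono-≤ (+-mono-≤ (+-mono-≤
              (0≤i*j (i≤j⇒0≤j-i 3≤x) (≤-trans (0≤2*i 0≤aᵢ) 2aᵢ≤aᵢ₊₁))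
              (i≤j⇒0≤j-i 2aᵢ≤aᵢ₊₁)) 0≤aᵢ) (0≤e i)

  nonNeg-and-doubles : ∀ i → 0ℤ ℤ.≤ a i × + 2 * a i ℤ.≤ a (suc i)
  nonNeg-and-doubles zero = 0≤a₀ , 2a₀≤a₁
  nonNeg-and-doubles (suc i) with nonNeg-and-doubles i
  ... | 0≤aᵢ , 2aᵢ≤aᵢ₊₁ =
    ≤-trans (0≤2*i 0≤aᵢ) 2aᵢ≤aᵢ₊₁ , doubling-step i 0≤aᵢ 2aᵢ≤aᵢ₊₁

  nonNeg : ∀ i → 0ℤ ℤ.≤ a i
  nonNeg i = proj₁ (nonNeg-and-doubles i)

  doubles : ∀ i → + 2 * a i ℤ.≤ a (suc i)
  doubles i = proj₂ (nonNeg-and-doubles i)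

  increasing : ∀ i → a i ℤ.≤ a (suc i)
  increasing i = begin
    a i         ≡⟨ sym (*-identityˡ (a i)) ⟩
    + 1 * a i   ≤⟨ *-monoʳ-≤-nonNeg (a i) {{nonNegative (nonNeg i)}} {+ 1} {+ 2}
                     (+≤+ (s≤s z≤n)) ⟩
    + 2 * a i   ≤⟨ doubles i ⟩
    a (suc i)   ∎
    where open ≤-Reasoning

  2^i*a₀≤aᵢ : ∀ i → + (2 ^ i) * a 0 ℤ.≤ a i
  2^i*a₀≤aᵢ zero = subst (ℤ._≤ a 0) (sym (*-identityˡ (a 0))) ≤-refl
  2^i*a₀≤aᵢ (suc i) = begin
    + (2 ^ suc i) * a 0     ≡⟨ cong (_* a 0) (pos-* 2 (2 ^ i)) ⟩
    + 2 * + (2 ^ i) * a 0   ≡⟨ *-assoc (+ 2) (+ (2 ^ i)) (a 0) ⟩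
    + 2 * (+ (2 ^ i) * a 0) ≤⟨ *-monoˡ-≤-nonNeg (+ 2) (2^i*a₀≤aᵢ i) ⟩
    + 2 * a i               ≤⟨ doubles i ⟩
    a (suc i)               ∎
    where open ≤-Reasoning

module _ {k : ℕ} (3≤k : 3 ≤ k) where

  private
    module Gₖ = PerturbedRecurrence (+ k) (+≤+ 3≤k) (λ i → G i (+ k)) (λ _ → 0ℤ)
      (λ i → sym (+-identityʳ _)) (λ _ → ≤-refl) (+≤+ z≤n) (+≤+ (ℕ.<⇒≤ 3≤k))

  G-nonNeg : ∀ i → 0ℤ ℤ.≤ G i (+ k)
  G-nonNeg = Gₖ.nonNeg

  2^i≤G : ∀ i → + (2 ^ i) ℤ.≤ G i (+ k)
  2^i≤G i = subst (ℤ._≤ G i (+ k)) (*-identityʳ (+ (2 ^ i))) (Gₖ.2^i*a₀≤aᵢ i)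

  index≤⌈log₂⌉ : ∀ {i n} → G i (+ k) ≡ + n → i ≤ ⌈log₂ n ⌉
  index≤⌈log₂⌉ {i} {n} Gᵢ≡n = subst (_≤ ⌈log₂ n ⌉) (⌈log₂2^n⌉≡n i)
    (⌈log₂⌉-mono-≤ (drop‿+≤+ (subst (+ (2 ^ i) ℤ.≤_) Gᵢ≡n (2^i≤G i))))

  module _ {k' : ℕ} (k≤k' : k ≤ k') where

    private
      d : ℕ → ℤ
      d i = G i (+ k') - G i (+ k)

      open PerturbedRecurrence (+ k') (+≤+ (ℕ.≤-trans 3≤k k≤k')) d
        (λ i → (+ k' - + k) * G (suc i) (+ k))
        (λ i → difference-identity (+ k) (+ k') (G i (+ k)) (G (suc i) (+ k))
                                               (G i (+ k')) (G (suc i) (+ k')))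
        (λ i → 0≤i*j (i≤j⇒0≤j-i (+≤+ k≤k')) (G-nonNeg (suc i)))
        (i≤j⇒0≤j-i (≤-refl {+ 1})) (i≤j⇒0≤j-i (+≤+ k≤k'))
        using (increasing)

    G-difference-grows : ∀ j → + k' - + k ℤ.≤ G (suc j) (+ k') - G (suc j) (+ k)
    G-difference-grows zero = ≤-refl
    G-difference-grows (suc j) = ≤-trans (G-difference-grows j) (increasing (suc j))

    G-injective-≤ : ∀ j → G (suc j) (+ k) ≡ G (suc j) (+ k') → k ≡ k'
    G-injective-≤ j Gk≡Gk' = ℕ.≤-antisym k≤k' (drop‿+≤+ (i-j≤0⇒i≤j (begin
      + k' - + k                            ≤⟨ G-difference-grows j ⟩
      G (suc j) (+ k') - G (suc j) (+ k)    ≡⟨ cong (G (suc j) (+ k') -_) Gk≡Gk' ⟩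
      G (suc j) (+ k') - G (suc j) (+ k')   ≡⟨ +-inverseʳ (G (suc j) (+ k')) ⟩
      0ℤ                                    ∎)))
      where open ≤-Reasoning

G-injective : ∀ {k k'} → 3 ≤ k → 3 ≤ k' →
              ∀ j → G (suc j) (+ k) ≡ G (suc j) (+ k') → k ≡ k'
G-injective {k} {k'} 3≤k 3≤k' j eq with ℕ.≤-total k k'
... | inj₁ k≤k' = G-injective-≤ 3≤k k≤k' j eq
... | inj₂ k'≤k = sym (G-injective-≤ 3≤k' k'≤k j (sym eq))

Unique⇒lookup-injective : ∀ {a} {A : Set a} {xs : List A} → Unique xs →
  Injective _≡_ _≡_ (lookup xs)
Unique⇒lookup-injective {xs = _ ∷ _} _ {Fin.zero} {Fin.zero} _ = refl
Unique⇒lookup-injective {xs = _ ∷ _} (x∉xs ∷ _) {Fin.zero} {Fin.suc q} eq =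
  contradiction eq (All.lookup x∉xs (∈-lookup q))
Unique⇒lookup-injective {xs = _ ∷ _} (x∉xs ∷ _) {Fin.suc p} {Fin.zero} eq =
  contradiction (sym eq) (All.lookup x∉xs (∈-lookup p))
Unique⇒lookup-injective {xs = _ ∷ _} (_ ∷ unique) {Fin.suc p} {Fin.suc q} eq =
  cong Fin.suc (Unique⇒lookup-injective unique eq)

module _ {a r m} {A : Set a} (R : A → Fin m → Set r)
         (R-injective : ∀ {x y} j → R x j → R y j → x ≡ y) where

  length-≤-labels : ∀ {xs} → Unique xs → All (λ x → ∃ (R x)) xs → length xs ≤ m
  length-≤-labels {xs} unique labelled = injective⇒≤ label-injective
    where
    labelOf : ∀ {x} → x ∈ xs → ∃ (R x)
    labelOf = All.lookup labelled

    label : Fin (length xs) → Fin m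
    label p = proj₁ (labelOf (∈-lookup p))

    label-injective : Injective _≡_ _≡_ label
    label-injective {p} {q} eq = Unique⇒lookup-injective unique
      (R-injective (label p) (proj₂ (labelOf (∈-lookup p)))
                             (subst (R _) (sym eq) (proj₂ (labelOf (∈-lookup q)))))

-- j : Fin (pred ⌈log₂ n⌉) encodes the chain position 2 + j ≤ ⌈log₂ n⌉.
AppearsAt : (n k : ℕ) → Fin (pred ⌈log₂ n ⌉) → Set
AppearsAt n k j = 3 ≤ k × G (suc (suc (toℕ j))) (+ k) ≡ + n

appearsAt-injective : ∀ {n k k'} j → AppearsAt n k j → AppearsAt n k' j → k ≡ k'
appearsAt-injective j (3≤k , Gk≡n) (3≤k' , Gk'≡n) =
  G-injective 3≤k 3≤k' (suc (toℕ j)) (trans Gk≡n (sym Gk'≡n))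

appearsAt-index : ∀ {n k} → 3 ≤ k × ∃[ i ] (2 ≤ i × G i (+ k) ≡ + n) → ∃ (AppearsAt n k)
appearsAt-index {n} {k} (3≤k , suc (suc i) , s≤s (s≤s z≤n) , Gᵢ≡n) =
  fromℕ< i<pred[c] , 3≤k ,
  subst (λ t → G (suc (suc t)) (+ k) ≡ + n) (sym (toℕ-fromℕ< i<pred[c])) Gᵢ≡n
  where
  i<pred[c] : i < pred ⌈log₂ n ⌉
  i<pred[c] = ℕ.pred-mono-≤ (index≤⌈log₂⌉ 3≤k Gᵢ≡n)

lemma3p6 : (n : ℕ) → 2 ≤ n → (ks : List ℕ) → Unique ks →
    All (λ k → 3 ≤ k × ∃[ i ] (2 ≤ i × G i (+ k) ≡ + n)) ks →
    length ks < ⌈log₂ n ⌉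
lemma3p6 n n≥2 ks unique appears = begin-strict
  length ks       ≤⟨ length-≤-labels (AppearsAt n) appearsAt-injective unique
                       (All.map appearsAt-index appears) ⟩
  pred ⌈log₂ n ⌉  <⟨ ℕ.≤-reflexive (ℕ.suc-pred ⌈log₂ n ⌉ {{⌈log₂n⌉≢0}}) ⟩
  ⌈log₂ n ⌉       ∎
  where
  open ℕ.≤-Reasoning
  ⌈log₂n⌉≢0 : NonZero ⌈log₂ n ⌉
  ⌈log₂n⌉≢0 = >-nonZero (⌈log₂⌉-mono-≤ n≥2)
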